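{- Let $\mathbb{F}$ be a field, let $X=\{x_1,\ldots,x_n\}$ and $Z=\{z_1,\ldots,z_n\}$ be sets of variables, and let $R = \mathbb{F}\langle Z \rangle$. Let $f(x_1,\ldots,x_n) \in \mathbb{F}\langle X \rangle$. Suppose there exists an arithmetic circuit with set of input variables $X$ over the ring $R$ that computes $f(x_1,\ldots,x_n)$ as a function from $R^n$ to $R$. Then there exists a non-commutative arithmetic circuit over the field $\mathbb{F}$ computing the non-commutative polynomial $f$ that has the same number of sum gates, the same number of product gates, the same size and the same depth.
   Context: For a set of variables $Y$, $\mathbb{F}\langle Y\rangle$ is the ring of non-commutative polynomials over $\mathbb{F}$ in the non-commuting variables of $Y$ (formal $\mathbb{F}$-linear combinations of words over $Y$, product = concatenation extended bilinearly). An arithmetic circuit over a ring $S$ with input variables $x_1,\dots,x_n$ is a finite directed acyclic graph whose in-degree-0 nodes (leaves) are labeled by an input variable or an element of $S$, whose other nodes are labeled $+$ (sum gates, arbitrary positive in-degree) or $\times$ (product gates, in-degree exactly 2, with an ordered left and right child), with a designated output node (the unique node of out-degree 0). Its size is the number of edges and its depth is the length of the longest directed path from a leaf to the output. Over a ring $R$, each node computes a function $R^n\to R$: a leaf labeled $x_i$ returns the $i$-th coordinate, a leaf labeled by a ring element returns that element, a sum gate returns the sum of its children's values, and a product gate returns (left child's value)$\cdot$(right child's value) in that order; the circuit computes the function at the output node. A non-commutative arithmetic circuit over a field $\mathbb{F}$ has leaves labeled by input variables or field elements, and each node computes an element of $\mathbb{F}\langle X\rangle$ in the analogous way (product gates multiply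 left times right); it computes the polynomial at its output node. -}

module Defs where

open import Level using (Level; _⊔_) renaming (suc to lsuc)
open import Data.Nat using (ℕ; zero; suc; _<_) renaming (_+_ to _+ℕ_; _⊔_ to _⊔ℕ_)
open import Data.Fin using (Fin; zero; suc)
import Data.Fin as Fin
open import Data.List using (List; []; _∷_; foldr; map; _++_)
open import Data.List.NonEmpty using (List⁺; toList) renaming (length to length⁺)
import Data.List.Properties as ListP
open import Data.Product using (Σ; _×_; _,_; ∃)
open import Relation.Nullary using (¬_; yes; no)
open import Relation.Binary.PropositionalEquality using (_≡_)
open import Algebra.Bundles using (CommutativeRing)

record Field (c ℓ : Level) : Set (lsuc (c Level.⊔ ℓ)) where
  field
    commutativeRing : CommutativeRing c ℓ
  open CommutativeRing commutativeRing public
  field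
    1≉0 : ¬ (1# ≈ 0#)
    inverse : ∀ x → ¬ (x ≈ 0#) → Σ Carrier λ y → x * y ≈ 1#

-- A polynomial is represented by a finite list of terms (c , w) meaning
-- c · w; two representations are equal iff all coefficients agree.

module NCPoly {c ℓ : Level} (F : Field c ℓ) (n : ℕ) where
  open Field F

  Word : Set
  Word = List (Fin n)

  Poly : Set c
  Poly = List (Carrier × Word)

  coeff : Poly → Word → Carrier
  coeff [] w = 0#
  coeff ((a , u) ∷ p) w with ListP.≡-dec Fin._≟_ u w
  ... | yes _ = a + coeff p w
  ... | no _  = coeff p w

  _≈P_ : Poly → Poly → Set ℓ
  p ≈P q = ∀ w → coeff p w ≈ coeff q w

  zeroP : Poly
  zeroP = []

  constP : Carrier → Poly
  constP a = (a , []) ∷ []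

  oneP : Poly
  oneP = constP 1#

  varP : Fin n → Poly
  varP i = (1# , i ∷ []) ∷ []

  _+P_ : Poly → Poly → Poly
  p +P q = p ++ q

  _*P_ : Poly → Poly → Poly
  [] *P q = []
  ((a , u) ∷ p) *P q = map (λ { (b , v) → (a * b , u ++ v) }) q ++ (p *P q)

-- A circuit is a DAG given in topological order as
-- a snoc-list of gates; a gate may only refer to earlier nodes.  Node
-- references are de Bruijn style: in a gate appended to a circuit with k
-- nodes, a child is a Fin k, where zero is the most recently added node.
-- Leaves are labelled by an input variable (Fin n) or a constant from S;
-- sum gates have a non-empty list of children (arbitrary positive
-- in-degree, multi-edges allowed); product gates have an ordered left and
-- right child.  The output node is the last node added (index zero).

data Gate {a : Level} (S : Set a) (n k : ℕ) : Set a where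
  input : Fin n → Gate S n k
  const : S → Gate S n k
  add   : List⁺ (Fin k) → Gate S n k
  mul   : Fin k → Fin k → Gate S n k

data Gates {a : Level} (S : Set a) (n : ℕ) : ℕ → Set a where
  []  : Gates S n 0
  _▷_ : ∀ {k} → Gates S n k → Gate S n k → Gates S n (suc k)

-- A circuit with input variables x_0,…,x_{n-1}, leaf labels in S and
-- m+1 nodes (at least one node: the output).
Circuit : {a : Level} (S : Set a) (n m : ℕ) → Set a
Circuit S n m = Gates S n (suc m)

module _ {a : Level} {S : Set a} {n : ℕ} where

  children : ∀ {k} → Gate S n k → List (Fin k)
  children (input _) = []
  children (const _) = []
  children (add cs)  = toList cs
  children (mul l r) = l ∷ r ∷ []

  occ : ∀ {k} → Fin k → List (Fin k) → ℕ
  occ i [] = 0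
  occ i (j ∷ js) with i Fin.≟ j
  ... | yes _ = suc (occ i js)
  ... | no _  = occ i js

  outdeg : ∀ {k} → Gates S n k → Fin k → ℕ
  outdeg (g ▷ x) zero    = 0
  outdeg (g ▷ x) (suc i) = outdeg g i +ℕ occ i (children x)

  WellFormed : ∀ {m} → Circuit S n m → Set
  WellFormed {m} C = (i : Fin m) → 0 < outdeg C (suc i)

  indeg : ∀ {k} → Gate S n k → ℕ
  indeg (input _) = 0
  indeg (const _) = 0
  indeg (add cs)  = length⁺ cs
  indeg (mul _ _) = 2

  -- size = number of edges
  size : ∀ {k} → Gates S n k → ℕ
  size []      = 0
  size (g ▷ x) = size g +ℕ indeg x

  isSum : ∀ {k} → Gate S n k → ℕ
  isSum (add _) = 1
  isSum _       = 0

  isProd : ∀ {k} → Gate S n k → ℕ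
  isProd (mul _ _) = 1
  isProd _         = 0

  numSum : ∀ {k} → Gates S n k → ℕ
  numSum []      = 0
  numSum (g ▷ x) = numSum g +ℕ isSum x

  numProd : ∀ {k} → Gates S n k → ℕ
  numProd []      = 0
  numProd (g ▷ x) = numProd g +ℕ isProd x

  nodeDepth : ∀ {k} → Gates S n k → Fin k → ℕ
  nodeDepth (g ▷ input _) zero = 0
  nodeDepth (g ▷ const _) zero = 0
  nodeDepth (g ▷ add cs)  zero = suc (foldr _⊔ℕ_ 0 (map (nodeDepth g) (toList cs)))
  nodeDepth (g ▷ mul l r) zero = suc (nodeDepth g l ⊔ℕ nodeDepth g r)
  nodeDepth (g ▷ x) (suc i)    = nodeDepth g i

  depth : ∀ {m} → Circuit S n m → ℕ
  depth C = nodeDepth C zero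

  module Eval {b : Level} {A : Set b}
              (_⊕_ _⊗_ : A → A → A) (𝟘 : A) (⟦_⟧ : S → A) (ρ : Fin n → A) where

    nodeValue : ∀ {k} → Gates S n k → Fin k → A
    nodeValue (g ▷ input j) zero = ρ j
    nodeValue (g ▷ const s) zero = ⟦ s ⟧
    nodeValue (g ▷ add cs)  zero = foldr _⊕_ 𝟘 (map (nodeValue g) (toList cs))
    nodeValue (g ▷ mul l r) zero = nodeValue g l ⊗ nodeValue g r
    nodeValue (g ▷ x) (suc i)    = nodeValue g i

    value : ∀ {m} → Circuit S n m → A
    value C = nodeValue C zero

module Setting {c ℓ : Level} (F : Field c ℓ) (n : ℕ) where
  open Field F

  module PX = NCPoly F n
  module PZ = NCPoly F n

  R : Set c
  R = PZ.Poly

  evalWordR : PX.Word → (Fin n → R) → R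
  evalWordR [] r       = PZ.oneP
  evalWordR (i ∷ w) r  = r i PZ.*P evalWordR w r

  evalPolyR : PX.Poly → (Fin n → R) → R
  evalPolyR [] r            = PZ.zeroP
  evalPolyR ((a , w) ∷ p) r = (PZ.constP a PZ.*P evalWordR w r) PZ.+P evalPolyR p r

  ComputesFunction : ∀ {m} → Circuit R n m → PX.Poly → Set (c Level.⊔ ℓ)
  ComputesFunction C f =
    (r : Fin n → R) →
      Eval.value PZ._+P_ PZ._*P_ PZ.zeroP (λ s → s) r C PZ.≈P evalPolyR f r

  ComputesPoly : ∀ {m} → Circuit Carrier n m → PX.Poly → Set ℓ
  ComputesPoly C f =
    Eval.value PX._+P_ PX._*P_ PX.zeroP PX.constP PX.varP C PX.≈P f

{-# OPTIONS --safe #-}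

-- Replace every constant of R = F⟨Z⟩ by its constant term. Only leaf labels change, so the
-- shape of the circuit, and with it the gate counts, the size and the depth, is preserved.
-- To see that the new circuit computes f, feed the old one the inputs z_j^L. Substituting
-- x_j ↦ z_j^L stretches every letter of a word to L copies, so stretched polynomials only
-- have terms of degree divisible by L, while the non-constant parts of the constants only
-- add terms of degree k·L + o with 1 ≤ o ≤ D, where D (constDegree) bounds the degree the
-- constants contribute to a node: maxima at sums, sums at products. By induction over the
-- circuit, each node's value at z^L is the stretched value of the corresponding node of the
-- new circuit plus such misaligned terms (Decomposes). For L = D + 1 the misaligned terms
-- never reach a stretched word, so comparing coefficients at stretched words gives f.

module Submission where

open import Defs
open import Level using (Level)
open import Data.Nat using (ℕ)
open import Data.Product using (Σ; _×_)
open import Relation.Binary.PropositionalEquality using (_≡_)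

import Data.Nat as Nat
open Nat using (zero; suc; _≤_; _<_; _⊔_; z≤n; s≤s; NonZero)
open import Data.Nat.Properties
  using (≤-refl; ≤-trans; ≤-<-trans; <⇒≱; +-mono-≤; *-distribʳ-+; m≤m⊔n; m≤n⊔m; m≤n+m)
open import Data.Nat.Divisibility using (_∤_; divides; ∣m+n∣m⇒∣n; n∣m*n; ∣⇒≤)
open import Data.Fin using (Fin; zero; suc)
import Data.Fin as Fin
open import Data.List using (List; []; _∷_; [_]; _++_; map; foldr; length; replicate)
open import Data.List.NonEmpty using (toList) renaming (length to length⁺)
open import Data.List.Properties
  using (≡-dec; ∷-injectiveˡ; ∷-injectiveʳ; ++-cancelˡ; ++-assoc; map-++; map-cong; length-++; length-replicate)
open import Data.List.Relation.Unary.All using (All; []; _∷_)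
import Data.List.Relation.Unary.All as All
open import Data.List.Relation.Unary.All.Properties using (++⁺; map⁺)
open import Data.Product using (_,_; proj₁; proj₂; map₁; map₂; uncurry)
open import Function using (_∘_)
open import Relation.Binary.Bundles using (Setoid)
import Relation.Binary.Reasoning.Setoid as SetoidReasoning
import Relation.Binary.PropositionalEquality as ≡
open import Relation.Nullary using (Dec; yes; no; contradiction)
import Algebra.Properties.CommutativeSemigroup as CommutativeSemigroupProperties

module _ {a b} {S : Set a} {T : Set b} {n : ℕ} (φ : S → T) where
  open ≡ using (refl; sym; trans; cong; cong₂; subst)

  mapConstGate : ∀ {k} → Gate S n k → Gate T n k
  mapConstGate (input j) = input j
  mapConstGate (const s) = const (φ s)
  mapConstGate (add cs)  = add cs
  mapConstGate (mul l r) = mul l r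

  mapConst : ∀ {k} → Gates S n k → Gates T n k
  mapConst []      = []
  mapConst (g ▷ x) = mapConst g ▷ mapConstGate x

  numSum-mapConst : ∀ {k} (g : Gates S n k) → numSum (mapConst g) ≡ numSum g
  numSum-mapConst []            = refl
  numSum-mapConst (g ▷ input _) = cong (Nat._+ 0) (numSum-mapConst g)
  numSum-mapConst (g ▷ const _) = cong (Nat._+ 0) (numSum-mapConst g)
  numSum-mapConst (g ▷ add _)   = cong (Nat._+ 1) (numSum-mapConst g)
  numSum-mapConst (g ▷ mul _ _) = cong (Nat._+ 0) (numSum-mapConst g)

  numProd-mapConst : ∀ {k} (g : Gates S n k) → numProd (mapConst g) ≡ numProd g
  numProd-mapConst []            = refl
  numProd-mapConst (g ▷ input _) = cong (Nat._+ 0) (numProd-mapConst g)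
  numProd-mapConst (g ▷ const _) = cong (Nat._+ 0) (numProd-mapConst g)
  numProd-mapConst (g ▷ add _)   = cong (Nat._+ 0) (numProd-mapConst g)
  numProd-mapConst (g ▷ mul _ _) = cong (Nat._+ 1) (numProd-mapConst g)

  size-mapConst : ∀ {k} (g : Gates S n k) → size (mapConst g) ≡ size g
  size-mapConst []             = refl
  size-mapConst (g ▷ input _)  = cong (Nat._+ 0) (size-mapConst g)
  size-mapConst (g ▷ const _)  = cong (Nat._+ 0) (size-mapConst g)
  size-mapConst (g ▷ add cs)   = cong (Nat._+ length⁺ cs) (size-mapConst g)
  size-mapConst (g ▷ mul _ _)  = cong (Nat._+ 2) (size-mapConst g)

  nodeDepth-mapConst : ∀ {k} (g : Gates S n k) i → nodeDepth (mapConst g) i ≡ nodeDepth g i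
  nodeDepth-mapConst (g ▷ input _) zero = refl
  nodeDepth-mapConst (g ▷ const _) zero = refl
  nodeDepth-mapConst (g ▷ add cs)  zero =
    cong (λ ds → suc (foldr _⊔_ 0 ds)) (map-cong (nodeDepth-mapConst g) (toList cs))
  nodeDepth-mapConst (g ▷ mul l r) zero =
    cong₂ (λ d e → suc (d ⊔ e)) (nodeDepth-mapConst g l) (nodeDepth-mapConst g r)
  nodeDepth-mapConst (g ▷ input _) (suc i) = nodeDepth-mapConst g i
  nodeDepth-mapConst (g ▷ const _) (suc i) = nodeDepth-mapConst g i
  nodeDepth-mapConst (g ▷ add _)   (suc i) = nodeDepth-mapConst g i
  nodeDepth-mapConst (g ▷ mul _ _) (suc i) = nodeDepth-mapConst g i

  occ-irrelevant : ∀ {k} (i : Fin k) js → occ {S = T} {n = n} i js ≡ occ {S = S} {n = n} i js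
  occ-irrelevant i []       = refl
  occ-irrelevant i (j ∷ js) with i Fin.≟ j
  ... | yes _ = cong suc (occ-irrelevant i js)
  ... | no  _ = occ-irrelevant i js

  children-mapConstGate : ∀ {k} (x : Gate S n k) → children (mapConstGate x) ≡ children x
  children-mapConstGate (input _) = refl
  children-mapConstGate (const _) = refl
  children-mapConstGate (add _)   = refl
  children-mapConstGate (mul _ _) = refl

  outdeg-mapConst : ∀ {k} (g : Gates S n k) i → outdeg (mapConst g) i ≡ outdeg g i
  outdeg-mapConst (g ▷ x) zero    = refl
  outdeg-mapConst (g ▷ x) (suc i) = cong₂ Nat._+_ (outdeg-mapConst g i)
    (trans (cong (occ {S = T} {n = n} i) (children-mapConstGate x)) (occ-irrelevant i (children x)))

  wellFormed-mapConst : ∀ {m} (C : Circuit S n m) → WellFormed C → WellFormed (mapConst C)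
  wellFormed-mapConst C wf i = subst (0 <_) (sym (outdeg-mapConst C (suc i))) (wf i)

module _ where
  open Nat using (_+_; _*_)
  open ≡ using (trans; cong; subst)
  open import Data.Nat.Properties using (+-identityʳ; +-commutativeSemigroup)

  data Offset (L lo hi : ℕ) : ℕ → Set where
    offset : ∀ k {o} → lo ≤ o → o ≤ hi → Offset L lo hi (k * L + o)

  aligned : ∀ {L} k → Offset L 0 0 (k * L)
  aligned {L} k = subst (Offset L 0 0) (+-identityʳ (k * L)) (offset k z≤n z≤n)

  offset-weaken : ∀ {L lo lo′ hi hi′ m} → lo ≤ lo′ → hi′ ≤ hi → Offset L lo′ hi′ m → Offset L lo hi m
  offset-weaken lo≤lo′ hi′≤hi (offset k lo′≤o o≤hi′) = offset k (≤-trans lo≤lo′ lo′≤o) (≤-trans o≤hi′ hi′≤hi)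

  offset-+ : ∀ {L lo₁ hi₁ lo₂ hi₂ i j} →
             Offset L lo₁ hi₁ i → Offset L lo₂ hi₂ j → Offset L (lo₁ + lo₂) (hi₁ + hi₂) (i + j)
  offset-+ {L} (offset k₁ {o₁} lo≤o₁ o₁≤hi) (offset k₂ {o₂} lo≤o₂ o₂≤hi) =
    subst (Offset L _ _) regroup (offset (k₁ + k₂) (+-mono-≤ lo≤o₁ lo≤o₂) (+-mono-≤ o₁≤hi o₂≤hi))
    where
    open CommutativeSemigroupProperties +-commutativeSemigroup using (interchange)
    regroup : (k₁ + k₂) * L + (o₁ + o₂) ≡ (k₁ * L + o₁) + (k₂ * L + o₂)
    regroup = trans (cong (_+ (o₁ + o₂)) (*-distribʳ-+ L k₁ k₂)) (interchange (k₁ * L) (k₂ * L) o₁ o₂)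

  offset⇒∤ : ∀ {L hi m} → hi < L → Offset L 1 hi m → L ∤ m
  offset⇒∤ hi<L (offset k 1≤o o≤hi) L∣m =
    <⇒≱ (≤-<-trans o≤hi hi<L) (∣⇒≤ {{Nat.>-nonZero 1≤o}} (∣m+n∣m⇒∣n L∣m (n∣m*n k)))

module _ {a} {A : Set a} where
  open ≡ using (refl; sym; trans; cong; cong₂)

  stretch : ℕ → List A → List A
  stretch L []      = []
  stretch L (x ∷ w) = replicate L x ++ stretch L w

  stretch-++ : ∀ L u v → stretch L (u ++ v) ≡ stretch L u ++ stretch L v
  stretch-++ L []      v = refl
  stretch-++ L (x ∷ u) v =
    trans (cong (replicate L x ++_) (stretch-++ L u v)) (sym (++-assoc (replicate L x) _ _))

  length-stretch : ∀ L w → length (stretch L w) ≡ length w Nat.* L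
  length-stretch L []      = refl
  length-stretch L (x ∷ w) =
    trans (length-++ (replicate L x)) (cong₂ Nat._+_ (length-replicate L) (length-stretch L w))

  stretch-injective : ∀ L .{{_ : NonZero L}} {u v} → stretch L u ≡ stretch L v → u ≡ v
  stretch-injective (suc k) {[]}    {[]}    _  = refl
  stretch-injective (suc k) {x ∷ u} {y ∷ v} eq with refl ← ∷-injectiveˡ eq =
    cong (x ∷_) (stretch-injective (suc k) (++-cancelˡ (replicate k x) _ _ (∷-injectiveʳ eq)))

module NCPolyProperties {c ℓ : Level} (F : Field c ℓ) (n : ℕ) where
  open Field F
  open NCPoly F n
  open ≡ using (_≢_; cong; cong₂)
  open CommutativeSemigroupProperties +-commutativeSemigroup using (interchange)
  module ≈-Reasoning = SetoidReasoning setoid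

  ∑ : ∀ {a} {A : Set a} → List A → (A → Carrier) → Carrier
  ∑ []       f = 0#
  ∑ (x ∷ xs) f = f x + ∑ xs f

  module _ {a} {A : Set a} where

    ∑-cong : ∀ (xs : List A) {f g} → (∀ x → f x ≈ g x) → ∑ xs f ≈ ∑ xs g
    ∑-cong []       f≈g = refl
    ∑-cong (x ∷ xs) f≈g = +-cong (f≈g x) (∑-cong xs f≈g)

    ∑-zero : ∀ (xs : List A) {f} → (∀ x → f x ≈ 0#) → ∑ xs f ≈ 0#
    ∑-zero []       f≈0 = refl
    ∑-zero (x ∷ xs) f≈0 = trans (+-cong (f≈0 x) (∑-zero xs f≈0)) (+-identityʳ 0#)

    ∑-+ : ∀ (xs : List A) f g → ∑ xs (λ x → f x + g x) ≈ ∑ xs f + ∑ xs g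
    ∑-+ []       f g = sym (+-identityʳ 0#)
    ∑-+ (x ∷ xs) f g = trans (+-congˡ (∑-+ xs f g)) (interchange (f x) (g x) (∑ xs f) (∑ xs g))

    ∑-map : ∀ {b} {B : Set b} (h : A → B) (xs : List A) f → ∑ (map h xs) f ≡ ∑ xs (f ∘ h)
    ∑-map h []       f = ≡.refl
    ∑-map h (x ∷ xs) f = cong (f (h x) +_) (∑-map h xs f)

  splits : Word → List (Word × Word)
  splits []      = ([] , []) ∷ []
  splits (x ∷ w) = ([] , x ∷ w) ∷ map (map₁ (x ∷_)) (splits w)

  _⋆_ : (Word → Carrier) → (Word → Carrier) → Word → Carrier
  (f ⋆ g) w = ∑ (splits w) (λ st → f (proj₁ st) * g (proj₂ st))

  ⋆-∷ : ∀ f g x w → (f ⋆ g) (x ∷ w) ≡ f [] * g (x ∷ w) + ((f ∘ (x ∷_)) ⋆ g) w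
  ⋆-∷ f g x w = cong (f [] * g (x ∷ w) +_) (∑-map (map₁ (x ∷_)) (splits w) _)

  ⋆-cong : ∀ {f f′ g g′} → (∀ s → f s ≈ f′ s) → (∀ t → g t ≈ g′ t) → ∀ w → (f ⋆ g) w ≈ (f′ ⋆ g′) w
  ⋆-cong f≈f′ g≈g′ w = ∑-cong (splits w) (λ st → *-cong (f≈f′ (proj₁ st)) (g≈g′ (proj₂ st)))

  ⋆-zeroˡ : ∀ {f} g → (∀ s → f s ≈ 0#) → ∀ w → (f ⋆ g) w ≈ 0#
  ⋆-zeroˡ g f≈0 w = ∑-zero (splits w) (λ st → trans (*-congʳ (f≈0 (proj₁ st))) (zeroˡ _))

  ⋆-zeroʳ : ∀ f {g} → (∀ t → g t ≈ 0#) → ∀ w → (f ⋆ g) w ≈ 0#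
  ⋆-zeroʳ f g≈0 w = ∑-zero (splits w) (λ st → trans (*-congˡ (g≈0 (proj₂ st))) (zeroʳ _))

  ⋆-distribˡ : ∀ f g h w → (f ⋆ (λ t → g t + h t)) w ≈ (f ⋆ g) w + (f ⋆ h) w
  ⋆-distribˡ f g h w = trans (∑-cong (splits w) (λ st → distribˡ (f (proj₁ st)) _ _)) (∑-+ (splits w) _ _)

  ⋆-distribʳ : ∀ f g h w → ((λ s → f s + g s) ⋆ h) w ≈ (f ⋆ h) w + (g ⋆ h) w
  ⋆-distribʳ f g h w = trans (∑-cong (splits w) (λ st → distribʳ (h (proj₂ st)) _ _)) (∑-+ (splits w) _ _)

  coeff-++ : ∀ p q w → coeff (p ++ q) w ≈ coeff p w + coeff q w
  coeff-++ []            q w = sym (+-identityˡ _)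
  coeff-++ ((a , u) ∷ p) q w with ≡-dec Fin._≟_ u w
  ... | yes _ = trans (+-congˡ (coeff-++ p q w)) (sym (+-assoc a _ _))
  ... | no  _ = coeff-++ p q w

  coeff-∉ : ∀ {p w} → All (λ t → proj₂ t ≢ w) p → coeff p w ≈ 0#
  coeff-∉ [] = refl
  coeff-∉ {(a , u) ∷ p} {w} (u≢w ∷ p∌w) with ≡-dec Fin._≟_ u w
  ... | yes u≡w = contradiction u≡w u≢w
  ... | no  _   = coeff-∉ p∌w

  coeff-map₂ : ∀ {h : Word → Word} → (∀ {u v} → h u ≡ h v → u ≡ v) →
               ∀ p w → coeff (map (map₂ h) p) (h w) ≡ coeff p w
  coeff-map₂ h-inj []            w = ≡.refl
  coeff-map₂ {h} h-inj ((a , u) ∷ p) w with ≡-dec Fin._≟_ (h u) (h w) | ≡-dec Fin._≟_ u w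
  ... | yes _     | yes _   = cong (a +_) (coeff-map₂ h-inj p w)
  ... | no  _     | no  _   = coeff-map₂ h-inj p w
  ... | yes hu≡hw | no  u≢w = contradiction (h-inj hu≡hw) u≢w
  ... | no  hu≢hw | yes u≡w = contradiction (cong h u≡w) hu≢hw

  coeff-∷-cong : ∀ {a b} → a ≈ b → ∀ u p w → coeff ((a , u) ∷ p) w ≈ coeff ((b , u) ∷ p) w
  coeff-∷-cong a≈b u p w with ≡-dec Fin._≟_ u w
  ... | yes _ = +-congʳ a≈b
  ... | no  _ = refl

  coeff-monomial-*ˡ : ∀ a b u w → a * coeff [ (b , u) ] w ≈ coeff [ (a * b , u) ] w
  coeff-monomial-*ˡ a b u w with ≡-dec Fin._≟_ u w
  ... | yes _ = trans (distribˡ a b 0#) (+-congˡ (zeroʳ a))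
  ... | no  _ = zeroʳ a

  constant-⋆ : ∀ a g w → (coeff [ (a , []) ] ⋆ g) w ≈ a * g w
  constant-⋆ a g []      = trans (+-identityʳ _) (*-congʳ (+-identityʳ a))
  constant-⋆ a g (x ∷ w) = begin
    (coeff [ (a , []) ] ⋆ g) (x ∷ w)             ≡⟨ ⋆-∷ (coeff [ (a , []) ]) g x w ⟩
    (a + 0#) * g (x ∷ w) + ((λ _ → 0#) ⋆ g) w    ≈⟨ +-cong (*-congʳ (+-identityʳ a)) (⋆-zeroˡ g (λ _ → refl) w) ⟩
    a * g (x ∷ w) + 0#                           ≈⟨ +-identityʳ _ ⟩
    a * g (x ∷ w)                                ∎
    where open ≈-Reasoning

  monomial-⋆-monomial : ∀ a u b v w →
    (coeff [ (a , u) ] ⋆ coeff [ (b , v) ]) w ≈ coeff [ (a * b , u ++ v) ] w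
  monomial-⋆-monomial a []      b v w       = trans (constant-⋆ a _ w) (coeff-monomial-*ˡ a b v w)
  monomial-⋆-monomial a (y ∷ u) b v []      = trans (+-identityʳ _) (zeroˡ _)
  monomial-⋆-monomial a (y ∷ u) b v (x ∷ w) = begin
    (coeff [ (a , y ∷ u) ] ⋆ coeff [ (b , v) ]) (x ∷ w)
      ≡⟨ ⋆-∷ (coeff [ (a , y ∷ u) ]) (coeff [ (b , v) ]) x w ⟩
    0# * coeff [ (b , v) ] (x ∷ w) + ((coeff [ (a , y ∷ u) ] ∘ (x ∷_)) ⋆ coeff [ (b , v) ]) w
      ≈⟨ trans (+-congʳ (zeroˡ _)) (+-identityˡ _) ⟩
    ((coeff [ (a , y ∷ u) ] ∘ (x ∷_)) ⋆ coeff [ (b , v) ]) w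
      ≈⟨ byFirstLetter (y Fin.≟ x) ⟩
    coeff [ (a * b , y ∷ u ++ v) ] (x ∷ w) ∎
    where
    open ≈-Reasoning
    byFirstLetter : Dec (y ≡ x) →
      ((coeff [ (a , y ∷ u) ] ∘ (x ∷_)) ⋆ coeff [ (b , v) ]) w ≈ coeff [ (a * b , y ∷ u ++ v) ] (x ∷ w)
    byFirstLetter (yes ≡.refl) = begin
      ((coeff [ (a , y ∷ u) ] ∘ (y ∷_)) ⋆ coeff [ (b , v) ]) w
        ≈⟨ ⋆-cong (λ s → reflexive (coeff-map₂ {y ∷_} ∷-injectiveʳ [ (a , u) ] s)) (λ _ → refl) w ⟩
      (coeff [ (a , u) ] ⋆ coeff [ (b , v) ]) w
        ≈⟨ monomial-⋆-monomial a u b v w ⟩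
      coeff [ (a * b , u ++ v) ] w
        ≡⟨ coeff-map₂ {y ∷_} ∷-injectiveʳ [ (a * b , u ++ v) ] w ⟨
      coeff [ (a * b , y ∷ u ++ v) ] (y ∷ w) ∎
    byFirstLetter (no y≢x) = trans (⋆-zeroˡ _ (λ s → coeff-∉ ((y≢x ∘ ∷-injectiveˡ) ∷ [])) w)
                             (sym (coeff-∉ ((y≢x ∘ ∷-injectiveˡ) ∷ [])))

  *P-distribʳ-++ : ∀ p p′ q → (p ++ p′) *P q ≡ (p *P q) ++ (p′ *P q)
  *P-distribʳ-++ []            p′ q = ≡.refl
  *P-distribʳ-++ ((a , u) ∷ p) p′ q =
    ≡.trans (cong₂ _++_ ≡.refl (*P-distribʳ-++ p p′ q)) (≡.sym (++-assoc _ (p *P q) (p′ *P q)))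

  coeff-monomial-*P : ∀ a u q w → coeff ([ (a , u) ] *P q) w ≈ (coeff [ (a , u) ] ⋆ coeff q) w
  coeff-monomial-*P a u []            w = sym (⋆-zeroʳ (coeff [ (a , u) ]) (λ _ → refl) w)
  coeff-monomial-*P a u ((b , v) ∷ q) w = begin
    coeff ([ (a , u) ] *P ((b , v) ∷ q)) w
      ≈⟨ coeff-++ [ (a * b , u ++ v) ] ([ (a , u) ] *P q) w ⟩
    coeff [ (a * b , u ++ v) ] w + coeff ([ (a , u) ] *P q) w
      ≈⟨ +-cong (sym (monomial-⋆-monomial a u b v w)) (coeff-monomial-*P a u q w) ⟩
    (m ⋆ coeff [ (b , v) ]) w + (m ⋆ coeff q) w
      ≈⟨ ⋆-distribˡ m (coeff [ (b , v) ]) (coeff q) w ⟨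
    (m ⋆ (λ t → coeff [ (b , v) ] t + coeff q t)) w
      ≈⟨ ⋆-cong (λ _ → refl) (λ t → sym (coeff-++ [ (b , v) ] q t)) w ⟩
    (m ⋆ coeff ((b , v) ∷ q)) w ∎
    where
    open ≈-Reasoning
    m : Word → Carrier
    m = coeff [ (a , u) ]

  coeff-*P : ∀ p q w → coeff (p *P q) w ≈ (coeff p ⋆ coeff q) w
  coeff-*P []            q w = sym (⋆-zeroˡ (coeff q) (λ _ → refl) w)
  coeff-*P ((a , u) ∷ p) q w = begin
    coeff (((a , u) ∷ p) *P q) w
      ≡⟨ cong (λ r → coeff r w) (*P-distribʳ-++ [ (a , u) ] p q) ⟩
    coeff (([ (a , u) ] *P q) ++ (p *P q)) w
      ≈⟨ coeff-++ ([ (a , u) ] *P q) (p *P q) w ⟩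
    coeff ([ (a , u) ] *P q) w + coeff (p *P q) w
      ≈⟨ +-cong (coeff-monomial-*P a u q w) (coeff-*P p q w) ⟩
    (coeff [ (a , u) ] ⋆ coeff q) w + (coeff p ⋆ coeff q) w
      ≈⟨ ⋆-distribʳ (coeff [ (a , u) ]) (coeff p) (coeff q) w ⟨
    ((λ s → coeff [ (a , u) ] s + coeff p s) ⋆ coeff q) w
      ≈⟨ ⋆-cong (λ s → sym (coeff-++ [ (a , u) ] p s)) (λ _ → refl) w ⟩
    (coeff ((a , u) ∷ p) ⋆ coeff q) w ∎
    where open ≈-Reasoning

  -- _≈P_ unfolds to a Π-type over coefficients, from which Agda cannot recover the two
  -- polynomials; wrapped in a record they become inferable.
  infix 4 _≋_
  record _≋_ (p q : Poly) : Set ℓ where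
    constructor coeffwise
    field coeff-≈ : p ≈P q
  open _≋_ public

  ≋-setoid : Setoid c ℓ
  ≋-setoid = record
    { Carrier       = Poly
    ; _≈_           = _≋_
    ; isEquivalence = record
      { refl  = coeffwise (λ _ → refl)
      ; sym   = λ p≋q → coeffwise (λ w → sym (coeff-≈ p≋q w))
      ; trans = λ p≋q q≋r → coeffwise (λ w → trans (coeff-≈ p≋q w) (coeff-≈ q≋r w))
      }
    }

  module ≋-Reasoning = SetoidReasoning ≋-setoid
  open Setoid ≋-setoid public using () renaming (refl to ≋-refl)

  ++-cong : ∀ {p p′ q q′} → p ≋ p′ → q ≋ q′ → p ++ q ≋ p′ ++ q′
  ++-cong {p} {p′} {q} {q′} p≋p′ q≋q′ = coeffwise λ w → begin
    coeff (p ++ q) w           ≈⟨ coeff-++ p q w ⟩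
    coeff p w + coeff q w      ≈⟨ +-cong (coeff-≈ p≋p′ w) (coeff-≈ q≋q′ w) ⟩
    coeff p′ w + coeff q′ w    ≈⟨ coeff-++ p′ q′ w ⟨
    coeff (p′ ++ q′) w         ∎
    where open ≈-Reasoning

  ++-interchange : ∀ p q r s → (p ++ q) ++ (r ++ s) ≋ (p ++ r) ++ (q ++ s)
  ++-interchange p q r s = coeffwise λ w → begin
    coeff ((p ++ q) ++ (r ++ s)) w
      ≈⟨ trans (coeff-++ (p ++ q) (r ++ s) w) (+-cong (coeff-++ p q w) (coeff-++ r s w)) ⟩
    (coeff p w + coeff q w) + (coeff r w + coeff s w)
      ≈⟨ interchange (coeff p w) (coeff q w) (coeff r w) (coeff s w) ⟩
    (coeff p w + coeff r w) + (coeff q w + coeff s w)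
      ≈⟨ trans (coeff-++ (p ++ r) (q ++ s) w) (+-cong (coeff-++ p r w) (coeff-++ q s w)) ⟨
    coeff ((p ++ r) ++ (q ++ s)) w ∎
    where open ≈-Reasoning

  *P-cong : ∀ {p p′ q q′} → p ≋ p′ → q ≋ q′ → p *P q ≋ p′ *P q′
  *P-cong {p} {p′} {q} {q′} p≋p′ q≋q′ = coeffwise λ w → begin
    coeff (p *P q) w           ≈⟨ coeff-*P p q w ⟩
    (coeff p ⋆ coeff q) w      ≈⟨ ⋆-cong (coeff-≈ p≋p′) (coeff-≈ q≋q′) w ⟩
    (coeff p′ ⋆ coeff q′) w    ≈⟨ coeff-*P p′ q′ w ⟨
    coeff (p′ *P q′) w         ∎
    where open ≈-Reasoning

  *P-distribˡ-++ : ∀ p q q′ → p *P (q ++ q′) ≋ (p *P q) ++ (p *P q′)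
  *P-distribˡ-++ p q q′ = coeffwise λ w → begin
    coeff (p *P (q ++ q′)) w
      ≈⟨ coeff-*P p (q ++ q′) w ⟩
    (coeff p ⋆ coeff (q ++ q′)) w
      ≈⟨ ⋆-cong (λ _ → refl) (coeff-++ q q′) w ⟩
    (coeff p ⋆ (λ t → coeff q t + coeff q′ t)) w
      ≈⟨ ⋆-distribˡ (coeff p) (coeff q) (coeff q′) w ⟩
    (coeff p ⋆ coeff q) w + (coeff p ⋆ coeff q′) w
      ≈⟨ +-cong (coeff-*P p q w) (coeff-*P p q′ w) ⟨
    coeff (p *P q) w + coeff (p *P q′) w
      ≈⟨ coeff-++ (p *P q) (p *P q′) w ⟨
    coeff ((p *P q) ++ (p *P q′)) w ∎
    where open ≈-Reasoning

  ∷-cong : ∀ {a b} → a ≈ b → ∀ u p → (a , u) ∷ p ≋ (b , u) ∷ p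
  ∷-cong a≈b u p = coeffwise (coeff-∷-cong a≈b u p)

  AllDegrees : (ℕ → Set) → Poly → Set c
  AllDegrees P = All (λ t → P (length (proj₂ t)))

  allDegrees-*P : (P Q R : ℕ → Set) → (∀ {i j} → P i → Q j → R (i Nat.+ j)) →
                  ∀ {p q} → AllDegrees P p → AllDegrees Q q → AllDegrees R (p *P q)
  allDegrees-*P P Q R _∙_ {[]}          []        _  = []
  allDegrees-*P P Q R _∙_ {(a , u) ∷ p} (Pu ∷ Pp) Qq =
    ++⁺ (map⁺ (All.map (λ {t} Qv → ≡.subst R (≡.sym (length-++ u)) (_∙_ {j = length (proj₂ t)} Pu Qv)) Qq))
        (allDegrees-*P P Q R _∙_ Pp Qq)

  constantTerm : Poly → Carrier
  constantTerm p = coeff p []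

  nonconstantPart : Poly → Poly
  nonconstantPart []                = []
  nonconstantPart ((a , [])    ∷ p) = nonconstantPart p
  nonconstantPart ((a , x ∷ u) ∷ p) = (a , x ∷ u) ∷ nonconstantPart p

  maxDegree : Poly → ℕ
  maxDegree []            = 0
  maxDegree ((_ , u) ∷ p) = length u ⊔ maxDegree p

  coeff-nonconstantPart-[] : ∀ p → coeff (nonconstantPart p) [] ≡ 0#
  coeff-nonconstantPart-[] []                = ≡.refl
  coeff-nonconstantPart-[] ((a , [])    ∷ p) = coeff-nonconstantPart-[] p
  coeff-nonconstantPart-[] ((a , x ∷ u) ∷ p) = coeff-nonconstantPart-[] p

  coeff-nonconstantPart-∷ : ∀ p y w → coeff (nonconstantPart p) (y ∷ w) ≡ coeff p (y ∷ w)
  coeff-nonconstantPart-∷ []                y w = ≡.refl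
  coeff-nonconstantPart-∷ ((a , [])    ∷ p) y w = coeff-nonconstantPart-∷ p y w
  coeff-nonconstantPart-∷ ((a , x ∷ u) ∷ p) y w with ≡-dec Fin._≟_ (x ∷ u) (y ∷ w)
  ... | yes _ = cong (a +_) (coeff-nonconstantPart-∷ p y w)
  ... | no  _ = coeff-nonconstantPart-∷ p y w

  constantTerm-split : ∀ p → p ≋ constP (constantTerm p) ++ nonconstantPart p
  constantTerm-split p = coeffwise split
    where
    split : ∀ w → coeff p w ≈ coeff (constP (constantTerm p) ++ nonconstantPart p) w
    split []      = sym (trans (+-congˡ (reflexive (coeff-nonconstantPart-[] p))) (+-identityʳ _))
    split (y ∷ w) = reflexive (≡.sym (coeff-nonconstantPart-∷ p y w))

  nonconstantPart-degrees : ∀ p → AllDegrees (λ d → 0 < d × d ≤ maxDegree p) (nonconstantPart p)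
  nonconstantPart-degrees []                = []
  nonconstantPart-degrees ((a , [])    ∷ p) = nonconstantPart-degrees p
  nonconstantPart-degrees ((a , x ∷ u) ∷ p) =
    (s≤s z≤n , m≤m⊔n (suc (length u)) (maxDegree p)) ∷
    All.map (map₂ (λ d≤ → ≤-trans d≤ (m≤n⊔m (suc (length u)) (maxDegree p)))) (nonconstantPart-degrees p)

  nodePoly : ∀ {k} → Gates Carrier n k → Fin k → Poly
  nodePoly = Eval.nodeValue _+P_ _*P_ zeroP constP varP

  constDegree : ∀ {k} → Gates Poly n k → Fin k → ℕ
  constDegree (g ▷ input _) zero    = 0
  constDegree (g ▷ const p) zero    = maxDegree p
  constDegree (g ▷ add cs)  zero    = foldr _⊔_ 0 (map (constDegree g) (toList cs))
  constDegree (g ▷ mul l r) zero    = constDegree g l Nat.+ constDegree g r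
  constDegree (g ▷ _)       (suc i) = constDegree g i

module Stretching {c ℓ : Level} (F : Field c ℓ) (n : ℕ) (L : ℕ) .{{_ : NonZero L}} where
  open Field F
  open NCPoly F n
  open NCPolyProperties F n
  open Setting F n using (evalWordR; evalPolyR)
  open ≡ using (_≢_; cong; cong₂)

  stretchP : Poly → Poly
  stretchP = map (map₂ (stretch L))

  stretchP-monomial-*P : ∀ a u q → stretchP ([ (a , u) ] *P q) ≡ [ (a , stretch L u) ] *P stretchP q
  stretchP-monomial-*P a u []            = ≡.refl
  stretchP-monomial-*P a u ((b , v) ∷ q) =
    cong₂ _∷_ (cong (a * b ,_) (stretch-++ L u v)) (stretchP-monomial-*P a u q)

  stretchP-*P : ∀ p q → stretchP (p *P q) ≡ stretchP p *P stretchP q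
  stretchP-*P []            q = ≡.refl
  stretchP-*P ((a , u) ∷ p) q = begin
    stretchP (((a , u) ∷ p) *P q)                           ≡⟨ cong stretchP (*P-distribʳ-++ [ (a , u) ] p q) ⟩
    stretchP (([ (a , u) ] *P q) ++ (p *P q))               ≡⟨ map-++ (map₂ (stretch L)) ([ (a , u) ] *P q) (p *P q) ⟩
    stretchP ([ (a , u) ] *P q) ++ stretchP (p *P q)        ≡⟨ cong₂ _++_ (stretchP-monomial-*P a u q) (stretchP-*P p q) ⟩
    ([ (a , stretch L u) ] *P stretchP q) ++ (stretchP p *P stretchP q)
                                                            ≡⟨ *P-distribʳ-++ [ (a , stretch L u) ] (stretchP p) (stretchP q) ⟨
    stretchP ((a , u) ∷ p) *P stretchP q                    ∎
    where open ≡.≡-Reasoning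

  coeff-stretchP : ∀ p w → coeff (stretchP p) (stretch L w) ≡ coeff p w
  coeff-stretchP = coeff-map₂ (stretch-injective L)

  stretchP-degrees : ∀ q → AllDegrees (Offset L 0 0) (stretchP q)
  stretchP-degrees []            = []
  stretchP-degrees ((a , u) ∷ q) =
    ≡.subst (Offset L 0 0) (≡.sym (length-stretch L u)) (aligned (length u)) ∷ stretchP-degrees q

  powers : Fin n → Poly
  powers j = stretchP (varP j)

  evalWordR-powers : ∀ u → evalWordR u powers ≋ stretchP [ (1# , u) ]
  evalWordR-powers []      = ≋-refl
  evalWordR-powers (i ∷ u) = begin
    powers i *P evalWordR u powers             ≈⟨ *P-cong {powers i} ≋-refl (evalWordR-powers u) ⟩
    powers i *P stretchP [ (1# , u) ]          ≡⟨ stretchP-*P (varP i) [ (1# , u) ] ⟨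
    stretchP [ (1# * 1# , i ∷ u) ]             ≈⟨ ∷-cong (*-identityˡ 1#) (stretch L (i ∷ u)) [] ⟩
    stretchP [ (1# , i ∷ u) ]                  ∎
    where open ≋-Reasoning

  evalPolyR-powers : ∀ f → evalPolyR f powers ≋ stretchP f
  evalPolyR-powers []            = ≋-refl
  evalPolyR-powers ((a , w) ∷ f) = begin
    (constP a *P evalWordR w powers) ++ evalPolyR f powers
      ≈⟨ ++-cong (*P-cong {constP a} ≋-refl (evalWordR-powers w)) (evalPolyR-powers f) ⟩
    (constP a *P stretchP [ (1# , w) ]) ++ stretchP f
      ≈⟨ ∷-cong (*-identityʳ a) (stretch L w) (stretchP f) ⟩
    stretchP ((a , w) ∷ f) ∎
    where open ≋-Reasoning

  record Decomposes (D : ℕ) (r q : Poly) : Set (c Level.⊔ ℓ) where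
    constructor decomposition
    field
      misalignedPart : Poly
      splitting      : r ≋ stretchP q ++ misalignedPart
      misaligned     : AllDegrees (Offset L 1 D) misalignedPart

  decomposes-input : ∀ j → Decomposes 0 (powers j) (varP j)
  decomposes-input j = decomposition [] ≋-refl []

  decomposes-const : ∀ p → Decomposes (maxDegree p) p (constP (constantTerm p))
  decomposes-const p =
    decomposition (nonconstantPart p) (constantTerm-split p) (All.map (uncurry (offset 0)) (nonconstantPart-degrees p))

  decomposes-+ : ∀ {D₁ D₂ r₁ r₂ q₁ q₂} → Decomposes D₁ r₁ q₁ → Decomposes D₂ r₂ q₂ →
                 Decomposes (D₁ ⊔ D₂) (r₁ ++ r₂) (q₁ ++ q₂)
  decomposes-+ {D₁} {D₂} {r₁} {r₂} {q₁} {q₂} (decomposition B₁ r₁≋ B₁-off) (decomposition B₂ r₂≋ B₂-off) =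
    decomposition (B₁ ++ B₂) splitting
      (++⁺ (All.map (offset-weaken ≤-refl (m≤m⊔n D₁ D₂)) B₁-off) (All.map (offset-weaken ≤-refl (m≤n⊔m D₁ D₂)) B₂-off))
    where
    open ≋-Reasoning
    splitting : r₁ ++ r₂ ≋ stretchP (q₁ ++ q₂) ++ (B₁ ++ B₂)
    splitting = begin
      r₁ ++ r₂                                      ≈⟨ ++-cong r₁≋ r₂≋ ⟩
      (stretchP q₁ ++ B₁) ++ (stretchP q₂ ++ B₂)    ≈⟨ ++-interchange (stretchP q₁) B₁ (stretchP q₂) B₂ ⟩
      (stretchP q₁ ++ stretchP q₂) ++ (B₁ ++ B₂)    ≡⟨ cong (_++ (B₁ ++ B₂)) (map-++ (map₂ (stretch L)) q₁ q₂) ⟨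
      stretchP (q₁ ++ q₂) ++ (B₁ ++ B₂)             ∎

  decomposes-sum : ∀ {a} {I : Set a} {D : I → ℕ} {r q : I → Poly} →
                   (∀ i → Decomposes (D i) (r i) (q i)) → ∀ is →
                   Decomposes (foldr _⊔_ 0 (map D is)) (foldr _+P_ zeroP (map r is)) (foldr _+P_ zeroP (map q is))
  decomposes-sum d []       = decomposition [] ≋-refl []
  decomposes-sum d (i ∷ is) = decomposes-+ (d i) (decomposes-sum d is)

  decomposes-* : ∀ {D₁ D₂ r₁ r₂ q₁ q₂} → Decomposes D₁ r₁ q₁ → Decomposes D₂ r₂ q₂ →
                 Decomposes (D₁ Nat.+ D₂) (r₁ *P r₂) (q₁ *P q₂)
  decomposes-* {D₁} {D₂} {r₁} {r₂} {q₁} {q₂} (decomposition B₁ r₁≋ B₁-off) (decomposition B₂ r₂≋ B₂-off) =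
    decomposition rest splitting rest-misaligned
    where
    s₁ : Poly
    s₁ = stretchP q₁
    s₂ : Poly
    s₂ = stretchP q₂
    rest : Poly
    rest = (s₁ *P B₂) ++ (B₁ *P (s₂ ++ B₂))
    Misaligned : ℕ → Set
    Misaligned = Offset L 1 (D₁ Nat.+ D₂)

    open ≋-Reasoning
    splitting : r₁ *P r₂ ≋ stretchP (q₁ *P q₂) ++ rest
    splitting = begin
      r₁ *P r₂                                         ≈⟨ *P-cong r₁≋ r₂≋ ⟩
      (s₁ ++ B₁) *P (s₂ ++ B₂)                         ≡⟨ *P-distribʳ-++ s₁ B₁ (s₂ ++ B₂) ⟩
      (s₁ *P (s₂ ++ B₂)) ++ (B₁ *P (s₂ ++ B₂))         ≈⟨ ++-cong (*P-distribˡ-++ s₁ s₂ B₂) ≋-refl ⟩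
      ((s₁ *P s₂) ++ (s₁ *P B₂)) ++ (B₁ *P (s₂ ++ B₂)) ≡⟨ ++-assoc (s₁ *P s₂) (s₁ *P B₂) _ ⟩
      (s₁ *P s₂) ++ rest                               ≡⟨ cong (_++ rest) (stretchP-*P q₁ q₂) ⟨
      stretchP (q₁ *P q₂) ++ rest                      ∎

    aligned·misaligned : ∀ {i j} → Offset L 0 0 i → Offset L 1 D₂ j → Misaligned (i Nat.+ j)
    aligned·misaligned i-off j-off = offset-weaken ≤-refl (m≤n+m D₂ D₁) (offset-+ i-off j-off)

    misaligned·any : ∀ {i j} → Offset L 1 D₁ i → Offset L 0 D₂ j → Misaligned (i Nat.+ j)
    misaligned·any = offset-+

    r₂-degrees : AllDegrees (Offset L 0 D₂) (s₂ ++ B₂)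
    r₂-degrees = ++⁺ (All.map (offset-weaken z≤n z≤n) (stretchP-degrees q₂)) (All.map (offset-weaken z≤n ≤-refl) B₂-off)

    rest-misaligned : AllDegrees Misaligned rest
    rest-misaligned =
      ++⁺ (allDegrees-*P (Offset L 0 0) (Offset L 1 D₂) Misaligned aligned·misaligned (stretchP-degrees q₁) B₂-off)
          (allDegrees-*P (Offset L 1 D₁) (Offset L 0 D₂) Misaligned misaligned·any B₁-off r₂-degrees)

  valueAtPowers : ∀ {k} → Gates Poly n k → Fin k → Poly
  valueAtPowers = Eval.nodeValue _+P_ _*P_ zeroP (λ p → p) powers

  decomposes-node : ∀ {k} (g : Gates Poly n k) i →
                    Decomposes (constDegree g i) (valueAtPowers g i) (nodePoly (mapConst constantTerm g) i)
  decomposes-node (g ▷ input j) zero    = decomposes-input j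
  decomposes-node (g ▷ const p) zero    = decomposes-const p
  decomposes-node (g ▷ add cs)  zero    = decomposes-sum (decomposes-node g) (toList cs)
  decomposes-node (g ▷ mul l r) zero    = decomposes-* (decomposes-node g l) (decomposes-node g r)
  decomposes-node (g ▷ input _) (suc i) = decomposes-node g i
  decomposes-node (g ▷ const _) (suc i) = decomposes-node g i
  decomposes-node (g ▷ add _)   (suc i) = decomposes-node g i
  decomposes-node (g ▷ mul _ _) (suc i) = decomposes-node g i

  coeff-stretch-decomposes : ∀ {D r q} → D < L → Decomposes D r q → ∀ w → coeff r (stretch L w) ≈ coeff q w
  coeff-stretch-decomposes {D} {r} {q} D<L (decomposition B r≋ B-off) w = begin
    coeff r (stretch L w)                                        ≈⟨ coeff-≈ r≋ (stretch L w) ⟩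
    coeff (stretchP q ++ B) (stretch L w)                        ≈⟨ coeff-++ (stretchP q) B (stretch L w) ⟩
    coeff (stretchP q) (stretch L w) + coeff B (stretch L w)
      ≈⟨ +-cong (reflexive (coeff-stretchP q w)) (coeff-∉ (All.map ≢stretch B-off)) ⟩
    coeff q w + 0#                                               ≈⟨ +-identityʳ _ ⟩
    coeff q w                                                    ∎
    where
    open ≈-Reasoning
    ≢stretch : ∀ {u} → Offset L 1 D (length u) → u ≢ stretch L w
    ≢stretch u-off ≡.refl = offset⇒∤ D<L u-off (divides (length w) (length-stretch L w))

module _ {c ℓ : Level} (F : Field c ℓ) (n : ℕ) where
  open Field F using (_≈_)
  open NCPoly F n
  open NCPolyProperties F n
  open Setting F n using (evalPolyR; ComputesFunction; ComputesPoly)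

  computesPoly-mapConst : ∀ {m} (C : Circuit Poly n m) f →
                          ComputesFunction C f → ComputesPoly (mapConst constantTerm C) f
  computesPoly-mapConst C f computes w = begin
    coeff (nodePoly (mapConst constantTerm C) zero) w
      ≈⟨ coeff-stretch-decomposes ≤-refl (decomposes-node C zero) w ⟨
    coeff (valueAtPowers C zero) (stretch L w)
      ≈⟨ computes powers (stretch L w) ⟩
    coeff (evalPolyR f powers) (stretch L w)
      ≈⟨ coeff-≈ (evalPolyR-powers f) (stretch L w) ⟩
    coeff (stretchP f) (stretch L w)
      ≡⟨ coeff-stretchP f w ⟩
    coeff f w ∎
    where
    L : ℕ
    L = suc (constDegree C zero)
    open Stretching F n L
    open ≈-Reasoning

theorem2 : {c ℓ : Level} (F : Field c ℓ) (n : ℕ) →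
    let open Setting F n in
    (f : PX.Poly) (m : ℕ) (C : Circuit R n m) → WellFormed C →
    ComputesFunction C f →
    Σ ℕ λ m′ → Σ (Circuit (Field.Carrier F) n m′) λ C′ →
      WellFormed C′ × ComputesPoly C′ f ×
      numSum C′ ≡ numSum C × numProd C′ ≡ numProd C ×
      size C′ ≡ size C × depth C′ ≡ depth C
theorem2 F n f m C wf computes =
  m , mapConst constantTerm C ,
  wellFormed-mapConst constantTerm C wf , computesPoly-mapConst F n C f computes ,
  numSum-mapConst constantTerm C , numProd-mapConst constantTerm C ,
  size-mapConst constantTerm C , nodeDepth-mapConst constantTerm C zero
  where open NCPolyProperties F n using (constantTerm)
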